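{- At any time $t$ at which Random-deletion performs a deletion, one of the possible deletions is a correct move; hence Random-deletion takes a correct move with probability at least $\frac{1}{2}$ at every such step.
   Context: $T$ is a finite set of open parentheses, each $x\in T$ with unique congruent close parenthesis $\bar{x}$; well-formed means belonging to the Dyck language $S\to SS\mid\varepsilon\mid aS\bar{a}$. Input $\sigma=\sigma[1]\cdots\sigma[n]$ over $T\cup\bar{T}$. Random-deletion: scan left to right with a stack; push open parentheses; on a close parenthesis, delete it if the stack is empty, match (pop) it with the stack top if they match, and otherwise delete either the stack top or the current symbol with probability $1/2$ each independently; after the scan, delete the remaining stack symbols one at a time. Time starts at $t=0$ and increases by one at every match or deletion. Fix an optimal deletion-only solution ("the optimal algorithm"): a stack-based single-scan procedure that pushes opens, pops on a match and on a mismatch deletes the stack top or the current close parenthesis, using exactly the minimum number of deletions needed to make $\sigma$ well-formed; it determines which indices are deleted and which pairs of indices are matched. $A_t$ is the set of indices of symbols matched or deleted by Random-deletion up to and including time $t$; $A_t^{OPT}=\{i : i\in A_t \text{ or } i \text{ is matched by the optimal algorithm with some index in } A_t\}$. A deletion at time $t$ is a correct move if $|A_t^{OPT}\setminus A_t|\le|A_{t-1}^{OPT}\setminus A_{t-1}|$ and a wrong move otherwise. -}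

module Defs where

open import Data.Nat using (ℕ; _≤_)
open import Data.Nat.Properties using (_≟_)
open import Data.Fin using (Fin)
open import Data.Bool using (Bool; true; false)
open import Data.List using (List; []; _∷_; _++_; [_]; length; zip; upTo; filter)
open import Data.List.Relation.Unary.Any using (Any; any?)
open import Data.List.Membership.Propositional using (_∈_; _∉_)
open import Data.List.Membership.DecPropositional _≟_ using (_∈?_)
open import Data.Product using (_×_; _,_; proj₁; proj₂; ∃)
open import Data.Sum using (_⊎_)
open import Relation.Nullary using (¬_; Dec)
open import Relation.Nullary.Decidable using (_×-dec_; _⊎-dec_; ¬?)
open import Relation.Binary.PropositionalEquality using (_≡_; _≢_)
open import Relation.Binary.Construct.Closure.ReflexiveTransitive using (Star)

-- Alphabet: T = Fin k (an arbitrary finite set of open parentheses);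
-- each open parenthesis a has its congruent close parenthesis (close a).

data Sym (k : ℕ) : Set where
  open′  : Fin k → Sym k
  close′ : Fin k → Sym k

data Dyck {k : ℕ} : List (Sym k) → Set where
  dε    : Dyck []
  dcat  : ∀ {u v} → Dyck u → Dyck v → Dyck (u ++ v)
  dwrap : ∀ {a u} → Dyck u → Dyck (open′ a ∷ u ++ [ close′ a ])

keepBy : ∀ {A : Set} → List Bool → List A → List A
keepBy (true ∷ bs)  (x ∷ xs) = x ∷ keepBy bs xs
keepBy (false ∷ bs) (x ∷ xs) = keepBy bs xs
keepBy _ _ = []

countFalse : List Bool → ℕ
countFalse [] = 0
countFalse (true ∷ bs) = countFalse bs
countFalse (false ∷ bs) = ℕ.suc (countFalse bs)

-- The stack-based deletion-only single-scan procedure (shared by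
-- Random-deletion, where mismatch choices are random, and by the optimal
-- algorithm, where they are fixed).  Indices are 0-based positions in σ.

record Config (k : ℕ) : Set where
  constructor ⟨_,_,_,_,_⟩
  field
    rest    : List (ℕ × Sym k)
    stack   : List (ℕ × Fin k)
    done    : List ℕ             -- indices matched or deleted so far (A_t)
    matches : List (ℕ × ℕ)       -- matched pairs (open index , close index)
    dels    : List ℕ
open Config public

initial : ∀ {k} → List (Sym k) → Config k
initial σ = ⟨ zip (upTo (length σ)) σ , [] , [] , [] , [] ⟩

data Kind : Set where
  push match delete : Kind

-- One step of the procedure; `delete` steps and `match` steps advance time by one.
data Step {k : ℕ} : Kind → Config k → Config k → Set where
  pushS     : ∀ {i x r s A M D} →
              Step push ⟨ (i , open′ x) ∷ r , s , A , M , D ⟩ ⟨ r , (i , x) ∷ s , A , M , D ⟩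
  delEmpty  : ∀ {i x r A M D} →
              Step delete ⟨ (i , close′ x) ∷ r , [] , A , M , D ⟩ ⟨ r , [] , i ∷ A , M , i ∷ D ⟩
  matchS    : ∀ {i j x r s A M D} →
              Step match ⟨ (i , close′ x) ∷ r , (j , x) ∷ s , A , M , D ⟩
                         ⟨ r , s , i ∷ j ∷ A , (j , i) ∷ M , D ⟩
  delTop    : ∀ {i j x y r s A M D} → y ≢ x →
              Step delete ⟨ (i , close′ x) ∷ r , (j , y) ∷ s , A , M , D ⟩
                          ⟨ (i , close′ x) ∷ r , s , j ∷ A , M , j ∷ D ⟩
  delCur    : ∀ {i j x y r s A M D} → y ≢ x →
              Step delete ⟨ (i , close′ x) ∷ r , (j , y) ∷ s , A , M , D ⟩
                          ⟨ r , (j , y) ∷ s , i ∷ A , M , i ∷ D ⟩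
  delEnd    : ∀ {j y s A M D} →
              Step delete ⟨ [] , (j , y) ∷ s , A , M , D ⟩ ⟨ [] , s , j ∷ A , M , j ∷ D ⟩

AnyStep : ∀ {k} → Config k → Config k → Set
AnyStep c c' = ∃ λ κ → Step κ c c'

Reachable : ∀ {k} → List (Sym k) → Config k → Set
Reachable σ c = Star AnyStep (initial σ) c

Final : ∀ {k} → Config k → Set
Final c = rest c ≡ [] × stack c ≡ []

OptimalRun : ∀ {k} → List (Sym k) → Config k → Set
OptimalRun σ opt =
  Reachable σ opt × Final opt ×
  (∀ (b : List Bool) → length b ≡ length σ → Dyck (keepBy b σ) →
     length (dels opt) ≤ countFalse b)

-- A^OPT \ A : indices not in A that the optimal algorithm matches with
-- some index in A.

OptPartnerIn : List (ℕ × ℕ) → List ℕ → ℕ → Set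
OptPartnerIn M A i =
  Any (λ p → (proj₁ p ≡ i × proj₂ p ∈ A) ⊎ (proj₂ p ≡ i × proj₁ p ∈ A)) M

optPartnerIn? : ∀ M A i → Dec (OptPartnerIn M A i)
optPartnerIn? M A i =
  any? (λ p → ((proj₁ p ≟ i) ×-dec (proj₂ p ∈? A)) ⊎-dec ((proj₂ p ≟ i) ×-dec (proj₁ p ∈? A))) M

optMinus : ℕ → List (ℕ × ℕ) → List ℕ → ℕ
optMinus n M A =
  length (filter (λ i → ¬? (i ∈? A) ×-dec optPartnerIn? M A i) (upTo n))

CorrectMove : ∀ {k} → List (Sym k) → List (ℕ × ℕ) → Config k → Config k → Set
CorrectMove σ M c c' = optMinus (length σ) M (done c') ≤ optMinus (length σ) M (done c)

-- Every reachable configuration of the scan satisfies an invariant: the scanned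
-- prefix of the input is done or (for opens) on the stack, the stack is
-- descending, and the matching built so far pairs congruent symbols without
-- crossing and without enclosing any stacked symbol.  Deleting an index is
-- correct as soon as all its optimal partners are already done.  For a close
-- parenthesis under an empty stack, or an open left at the end, the invariant
-- of the optimal run forces this.  At a mismatch between stack top j and
-- current symbol i: if the optimal partner b of j is not yet done, then
-- j < i < b, and an optimal partner a of i that is not done would lie deeper in
-- the stack, so a < j < i < b would make the optimal matching cross; hence
-- deleting i is correct.
module Submission where

open import Defs
open import Data.Nat using (ℕ; _<_; _>_; _≤_)
open import Data.Nat.Properties using (_≟_; <-irrefl; <-asym)
open import Data.List using (List; []; _∷_; _++_; [_]; zip; upTo; filter; length)
open import Data.List.Properties using (++-assoc)
open import Data.List.Relation.Unary.All as All using (All; []; _∷_)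
open import Data.List.Relation.Unary.AllPairs as AllPairs using (AllPairs; []; _∷_)
open import Data.List.Relation.Unary.AllPairs.Properties using (applyUpTo⁺₁)
open import Data.List.Relation.Unary.Any using (here; there; any?)
open import Data.List.Membership.Propositional using (_∈_; _∉_; find; lose)
open import Data.List.Membership.Propositional.Properties using (∈-++⁺ˡ; ∈-++⁺ʳ; ∈-++⁻)
open import Data.List.Membership.DecPropositional _≟_ using (_∈?_)
open import Data.List.Relation.Binary.Sublist.Propositional using (⊆-refl)
open import Data.List.Relation.Binary.Sublist.Propositional.Properties
  using (length-mono-≤; filter⁺)
open import Data.Product using (_×_; _,_; proj₁; proj₂; ∃)
open import Data.Sum using (_⊎_; inj₁; inj₂; [_,_]′)
open import Data.Empty using (⊥; ⊥-elim)
open import Function using (_on_; id)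
open import Level using (0ℓ)
open import Relation.Nullary using (yes; no)
open import Relation.Nullary.Decidable using (_×-dec_; ¬?; decidable-stable)
open import Relation.Unary using (Pred; Decidable)
open import Relation.Binary using (Rel)
open import Relation.Binary.PropositionalEquality using (_≡_; _≢_; refl; sym; trans; subst)
open import Relation.Binary.Construct.Closure.ReflexiveTransitive using (Star; ε; _◅_)

length-filter-mono : ∀ {A : Set} {P Q : Pred A 0ℓ} (P? : Decidable P) (Q? : Decidable Q) →
                     (∀ {x} → P x → Q x) → ∀ xs → length (filter P? xs) ≤ length (filter Q? xs)
length-filter-mono P? Q? P⇒Q xs = length-mono-≤ (filter⁺ P? Q? (λ { refl → P⇒Q }) (⊆-refl {x = xs}))

PartnersDone : List (ℕ × ℕ) → List ℕ → ℕ → Set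
PartnersDone M A x = ∀ {a b} → (a , b) ∈ M → (a ≡ x → b ∈ A) × (b ≡ x → a ∈ A)

optMinus-∷-≤ : ∀ n M A x → PartnersDone M A x → optMinus n M (x ∷ A) ≤ optMinus n M A
optMinus-∷-≤ n M A x x-done = length-filter-mono _ _ shrink (upTo n)
  where
  shrink : ∀ {i} → (i ∉ x ∷ A) × OptPartnerIn M (x ∷ A) i → (i ∉ A) × OptPartnerIn M A i
  shrink {i} (i∉ , partner) with find partner
  ... | p , p∈ , inj₁ (refl , here b≡x)  = ⊥-elim (i∉ (there (proj₂ (x-done p∈) b≡x)))
  ... | p , p∈ , inj₁ (refl , there b∈) = (λ i∈ → i∉ (there i∈)) , lose p∈ (inj₁ (refl , b∈))
  ... | p , p∈ , inj₂ (refl , here a≡x)  = ⊥-elim (i∉ (there (proj₁ (x-done p∈) a≡x)))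
  ... | p , p∈ , inj₂ (refl , there a∈) = (λ i∈ → i∉ (there i∈)) , lose p∈ (inj₂ (refl , a∈))

module _ {A : Set} {R : Rel A 0ℓ} where

  AllPairs-++-between : ∀ xs {ys} → AllPairs R (xs ++ ys) → ∀ {x y} → x ∈ xs → y ∈ ys → R x y
  AllPairs-++-between (_ ∷ xs) (px ∷ _) (here refl) y∈ = All.lookup px (∈-++⁺ʳ xs y∈)
  AllPairs-++-between (_ ∷ xs) (_ ∷ pxs) (there x∈) y∈ = AllPairs-++-between xs pxs x∈ y∈

  AllPairs-++⁻ʳ : ∀ xs {ys} → AllPairs R (xs ++ ys) → AllPairs R ys
  AllPairs-++⁻ʳ []       pys        = pys
  AllPairs-++⁻ʳ (_ ∷ xs) (_ ∷ pxys) = AllPairs-++⁻ʳ xs pxys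

module _ {A B : Set} where

  All-zip⁺ˡ : ∀ {P : Pred A 0ℓ} {xs} (ys : List B) → All P xs → All (λ p → P (proj₁ p)) (zip xs ys)
  All-zip⁺ˡ _        []         = []
  All-zip⁺ˡ []       (_ ∷ _)    = []
  All-zip⁺ˡ (_ ∷ ys) (px ∷ pxs) = px ∷ All-zip⁺ˡ ys pxs

  AllPairs-zip⁺ˡ : ∀ {R : Rel A 0ℓ} {xs} (ys : List B) →
                   AllPairs R xs → AllPairs (R on proj₁) (zip xs ys)
  AllPairs-zip⁺ˡ _        []         = []
  AllPairs-zip⁺ˡ []       (_ ∷ _)    = []
  AllPairs-zip⁺ˡ (_ ∷ ys) (px ∷ pxs) = All-zip⁺ˡ ys px ∷ AllPairs-zip⁺ˡ ys pxs

module _ {S : Set} where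

  Ascending : List (ℕ × S) → Set
  Ascending = AllPairs (_<_ on proj₁)

  ascending-functional : ∀ {E} → Ascending E → ∀ {i s t} → (i , s) ∈ E → (i , t) ∈ E → s ≡ t
  ascending-functional _          (here refl) (here refl) = refl
  ascending-functional (lt ∷ _)   (here refl) (there q)   = ⊥-elim (<-irrefl refl (All.lookup lt q))
  ascending-functional (lt ∷ _)   (there p)   (here refl) = ⊥-elim (<-irrefl refl (All.lookup lt p))
  ascending-functional (_ ∷ asc) (there p)   (there q)   = ascending-functional asc p q

  upTo-zip-ascending : ∀ n (σ : List S) → Ascending (zip (upTo n) σ)
  upTo-zip-ascending n σ = AllPairs-zip⁺ˡ σ (applyUpTo⁺₁ _ n (λ i<j _ → i<j))

∈-∷ʳ⁻ : ∀ {A : Set} (xs : List A) {x v} → v ∈ xs ++ [ x ] → v ∈ xs ⊎ v ≡ x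
∈-∷ʳ⁻ xs v∈ with ∈-++⁻ xs v∈
... | inj₁ v∈xs        = inj₁ v∈xs
... | inj₂ (here v≡x) = inj₂ v≡x

++-∷-shift : ∀ {A : Set} {E : List A} xs {x r} → E ≡ xs ++ x ∷ r → E ≡ (xs ++ [ x ]) ++ r
++-∷-shift xs {x} {r} split = trans split (sym (++-assoc xs [ x ] r))

module _ {k : ℕ} where

  MatchedIn : List (ℕ × Sym k) → ℕ × ℕ → Set
  MatchedIn P (a , b) = ∃ λ z → (a , open′ z) ∈ P × (b , close′ z) ∈ P × a < b

  MatchedIn-++⁺ : ∀ {P} Q {p} → MatchedIn P p → MatchedIn (P ++ Q) p
  MatchedIn-++⁺ Q (z , a∈ , b∈ , a<b) = z , ∈-++⁺ˡ a∈ , ∈-++⁺ˡ b∈ , a<b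

  record ScanInvariant (E : List (ℕ × Sym k)) (c : Config k) : Set where
    field
      scanned          : List (ℕ × Sym k)
      input-split      : E ≡ scanned ++ rest c
      scanned-open     : ∀ {a y} → (a , open′ y) ∈ scanned → a ∈ done c ⊎ (a , y) ∈ stack c
      scanned-close    : ∀ {b z} → (b , close′ z) ∈ scanned → b ∈ done c
      stacked-scanned  : ∀ {j y} → (j , y) ∈ stack c → (j , open′ y) ∈ scanned
      stack-descending : AllPairs (_>_ on proj₁) (stack c)
      matched-in       : ∀ {p} → p ∈ matches c → MatchedIn scanned p
      noncrossing      : ∀ {a b a′ b′} → (a , b) ∈ matches c → (a′ , b′) ∈ matches c →
                         a < a′ → a′ < b → b < b′ → ⊥
      stack-unenclosed : ∀ {a b j y} → (a , b) ∈ matches c → (j , y) ∈ stack c →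
                         a < j → j < b → ⊥
  open ScanInvariant

  initial-invariant : (σ : List (Sym k)) → ScanInvariant (zip (upTo (length σ)) σ) (initial σ)
  initial-invariant σ = record
    { scanned = [] ; input-split = refl ; scanned-open = λ () ; scanned-close = λ ()
    ; stacked-scanned = λ () ; stack-descending = [] ; matched-in = λ ()
    ; noncrossing = λ () ; stack-unenclosed = λ () }

  module _ {E : List (ℕ × Sym k)} (asc : Ascending E) where

    scanned-before-rest : ∀ {c} (I : ScanInvariant E c) {a s b t} →
                          (a , s) ∈ scanned I → (b , t) ∈ rest c → a < b
    scanned-before-rest I = AllPairs-++-between (scanned I) (subst Ascending (input-split I) asc)

    rest-ascending : ∀ {c} (I : ScanInvariant E c) → Ascending (rest c)
    rest-ascending I = AllPairs-++⁻ʳ (scanned I) (subst Ascending (input-split I) asc)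

    scanned⊆input : ∀ {c} (I : ScanInvariant E c) {v} → v ∈ scanned I → v ∈ E
    scanned⊆input I v∈ = subst (_ ∈_) (sym (input-split I)) (∈-++⁺ˡ v∈)

    rest⊆input : ∀ {c} (I : ScanInvariant E c) {v} → v ∈ rest c → v ∈ E
    rest⊆input I v∈ = subst (_ ∈_) (sym (input-split I)) (∈-++⁺ʳ (scanned I) v∈)

    stacked⊆input : ∀ {c} (I : ScanInvariant E c) {j y} → (j , y) ∈ stack c → (j , open′ y) ∈ E
    stacked⊆input I j∈ = scanned⊆input I (stacked-scanned I j∈)

    input-scanned-or-rest : ∀ {c} (I : ScanInvariant E c) {v} → v ∈ E → v ∈ scanned I ⊎ v ∈ rest c
    input-scanned-or-rest I v∈ = ∈-++⁻ (scanned I) (subst (_ ∈_) (input-split I) v∈)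

    push-preserves : ∀ {i x r s A M D} → ScanInvariant E ⟨ (i , open′ x) ∷ r , s , A , M , D ⟩ →
                     ScanInvariant E ⟨ r , (i , x) ∷ s , A , M , D ⟩
    push-preserves {i} {x} {r} {s} {A} {M} I = record
      { scanned = scanned I ++ [ (i , open′ x) ]
      ; input-split = ++-∷-shift (scanned I) (input-split I)
      ; scanned-open = λ v∈ → opens (∈-∷ʳ⁻ (scanned I) v∈)
      ; scanned-close = λ v∈ → closes (∈-∷ʳ⁻ (scanned I) v∈)
      ; stacked-scanned = stacked
      ; stack-descending = All.tabulate (λ j∈ → scanned-before-rest I (stacked-scanned I j∈) (here refl))
                           ∷ stack-descending I
      ; matched-in = λ p∈ → MatchedIn-++⁺ _ (matched-in I p∈)
      ; noncrossing = noncrossing I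
      ; stack-unenclosed = unenclosed
      }
      where
      opens : ∀ {a y} → (a , open′ y) ∈ scanned I ⊎ (a , open′ y) ≡ (i , open′ x) →
              a ∈ A ⊎ (a , y) ∈ (i , x) ∷ s
      opens (inj₁ a∈) with scanned-open I a∈
      ... | inj₁ a∈A = inj₁ a∈A
      ... | inj₂ a∈s = inj₂ (there a∈s)
      opens (inj₂ refl) = inj₂ (here refl)
      closes : ∀ {b z} → (b , close′ z) ∈ scanned I ⊎ (b , close′ z) ≡ (i , open′ x) → b ∈ A
      closes (inj₁ b∈) = scanned-close I b∈
      stacked : ∀ {j y} → (j , y) ∈ (i , x) ∷ s → (j , open′ y) ∈ scanned I ++ [ (i , open′ x) ]
      stacked (here refl) = ∈-++⁺ʳ (scanned I) (here refl)
      stacked (there j∈) = ∈-++⁺ˡ (stacked-scanned I j∈)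
      unenclosed : ∀ {a b j y} → (a , b) ∈ M → (j , y) ∈ (i , x) ∷ s → a < j → j < b → ⊥
      unenclosed p∈ (here refl) _ i<b =
        let (_ , _ , b∈ , _) = matched-in I p∈ in <-asym i<b (scanned-before-rest I b∈ (here refl))
      unenclosed p∈ (there j∈) = stack-unenclosed I p∈ j∈

    delete-unmatched-preserves : ∀ {i x r A M D} →
                                 ScanInvariant E ⟨ (i , close′ x) ∷ r , [] , A , M , D ⟩ →
                                 ScanInvariant E ⟨ r , [] , i ∷ A , M , i ∷ D ⟩
    delete-unmatched-preserves {i} {x} {r} {A} I = record
      { scanned = scanned I ++ [ (i , close′ x) ]
      ; input-split = ++-∷-shift (scanned I) (input-split I)
      ; scanned-open = λ v∈ → opens (∈-∷ʳ⁻ (scanned I) v∈)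
      ; scanned-close = λ v∈ → closes (∈-∷ʳ⁻ (scanned I) v∈)
      ; stacked-scanned = λ ()
      ; stack-descending = []
      ; matched-in = λ p∈ → MatchedIn-++⁺ _ (matched-in I p∈)
      ; noncrossing = noncrossing I
      ; stack-unenclosed = λ _ ()
      }
      where
      opens : ∀ {a y} → (a , open′ y) ∈ scanned I ⊎ (a , open′ y) ≡ (i , close′ x) →
              a ∈ i ∷ A ⊎ (a , y) ∈ []
      opens (inj₁ a∈) with scanned-open I a∈
      ... | inj₁ a∈A = inj₁ (there a∈A)
      closes : ∀ {b z} → (b , close′ z) ∈ scanned I ⊎ (b , close′ z) ≡ (i , close′ x) → b ∈ i ∷ A
      closes (inj₁ b∈) = there (scanned-close I b∈)
      closes (inj₂ refl) = here refl

    match-preserves : ∀ {i j x r s A M D} →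
                      ScanInvariant E ⟨ (i , close′ x) ∷ r , (j , x) ∷ s , A , M , D ⟩ →
                      ScanInvariant E ⟨ r , s , i ∷ j ∷ A , (j , i) ∷ M , D ⟩
    match-preserves {i} {j} {x} {r} {s} {A} {M} I = record
      { scanned = scanned I ++ [ (i , close′ x) ]
      ; input-split = ++-∷-shift (scanned I) (input-split I)
      ; scanned-open = λ v∈ → opens (∈-∷ʳ⁻ (scanned I) v∈)
      ; scanned-close = λ v∈ → closes (∈-∷ʳ⁻ (scanned I) v∈)
      ; stacked-scanned = λ j∈ → ∈-++⁺ˡ (stacked-scanned I (there j∈))
      ; stack-descending = AllPairs.tail (stack-descending I)
      ; matched-in = matched
      ; noncrossing = crossing
      ; stack-unenclosed = unenclosed
      }
      where
      j<i : j < i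
      j<i = scanned-before-rest I (stacked-scanned I (here refl)) (here refl)
      opens : ∀ {a y} → (a , open′ y) ∈ scanned I ⊎ (a , open′ y) ≡ (i , close′ x) →
              a ∈ i ∷ j ∷ A ⊎ (a , y) ∈ s
      opens (inj₁ a∈) with scanned-open I a∈
      ... | inj₁ a∈A         = inj₁ (there (there a∈A))
      ... | inj₂ (here refl) = inj₁ (there (here refl))
      ... | inj₂ (there a∈s) = inj₂ a∈s
      closes : ∀ {b z} → (b , close′ z) ∈ scanned I ⊎ (b , close′ z) ≡ (i , close′ x) → b ∈ i ∷ j ∷ A
      closes (inj₁ b∈) = there (there (scanned-close I b∈))
      closes (inj₂ refl) = here refl
      matched : ∀ {p} → p ∈ (j , i) ∷ M → MatchedIn (scanned I ++ [ (i , close′ x) ]) p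
      matched (here refl) =
        x , ∈-++⁺ˡ (stacked-scanned I (here refl)) , ∈-++⁺ʳ (scanned I) (here refl) , j<i
      matched (there p∈) = MatchedIn-++⁺ _ (matched-in I p∈)
      crossing : ∀ {a b a′ b′} → (a , b) ∈ (j , i) ∷ M → (a′ , b′) ∈ (j , i) ∷ M →
                 a < a′ → a′ < b → b < b′ → ⊥
      crossing (here refl) (here refl) lt _ _ = <-irrefl refl lt
      crossing (here refl) (there q∈) _ _ i<b′ =
        let (_ , _ , b′∈ , _) = matched-in I q∈ in <-asym i<b′ (scanned-before-rest I b′∈ (here refl))
      crossing (there p∈) (here refl) a<j j<b _ = stack-unenclosed I p∈ (here refl) a<j j<b
      crossing (there p∈) (there q∈) = noncrossing I p∈ q∈
      unenclosed : ∀ {a b j′ y} → (a , b) ∈ (j , i) ∷ M → (j′ , y) ∈ s → a < j′ → j′ < b → ⊥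
      unenclosed (here refl) j′∈ j<j′ _ =
        <-asym j<j′ (All.lookup (AllPairs.head (stack-descending I)) j′∈)
      unenclosed (there p∈) j′∈ = stack-unenclosed I p∈ (there j′∈)

    delete-top-preserves : ∀ {r j y s A M D} → ScanInvariant E ⟨ r , (j , y) ∷ s , A , M , D ⟩ →
                           ScanInvariant E ⟨ r , s , j ∷ A , M , j ∷ D ⟩
    delete-top-preserves {r} {j} {y} {s} {A} I = record
      { scanned = scanned I
      ; input-split = input-split I
      ; scanned-open = opens
      ; scanned-close = λ b∈ → there (scanned-close I b∈)
      ; stacked-scanned = λ j∈ → stacked-scanned I (there j∈)
      ; stack-descending = AllPairs.tail (stack-descending I)
      ; matched-in = matched-in I
      ; noncrossing = noncrossing I
      ; stack-unenclosed = λ p∈ j∈ → stack-unenclosed I p∈ (there j∈)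
      }
      where
      opens : ∀ {a y′} → (a , open′ y′) ∈ scanned I → a ∈ j ∷ A ⊎ (a , y′) ∈ s
      opens a∈ with scanned-open I a∈
      ... | inj₁ a∈A         = inj₁ (there a∈A)
      ... | inj₂ (here refl) = inj₁ (here refl)
      ... | inj₂ (there a∈s) = inj₂ a∈s

    delete-current-preserves : ∀ {i x r s A M D} →
                               ScanInvariant E ⟨ (i , close′ x) ∷ r , s , A , M , D ⟩ →
                               ScanInvariant E ⟨ r , s , i ∷ A , M , i ∷ D ⟩
    delete-current-preserves {i} {x} {r} {s} {A} I = record
      { scanned = scanned I ++ [ (i , close′ x) ]
      ; input-split = ++-∷-shift (scanned I) (input-split I)
      ; scanned-open = λ v∈ → opens (∈-∷ʳ⁻ (scanned I) v∈)
      ; scanned-close = λ v∈ → closes (∈-∷ʳ⁻ (scanned I) v∈)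
      ; stacked-scanned = λ j∈ → ∈-++⁺ˡ (stacked-scanned I j∈)
      ; stack-descending = stack-descending I
      ; matched-in = λ p∈ → MatchedIn-++⁺ _ (matched-in I p∈)
      ; noncrossing = noncrossing I
      ; stack-unenclosed = stack-unenclosed I
      }
      where
      opens : ∀ {a y} → (a , open′ y) ∈ scanned I ⊎ (a , open′ y) ≡ (i , close′ x) →
              a ∈ i ∷ A ⊎ (a , y) ∈ s
      opens (inj₁ a∈) with scanned-open I a∈
      ... | inj₁ a∈A = inj₁ (there a∈A)
      ... | inj₂ a∈s = inj₂ a∈s
      closes : ∀ {b z} → (b , close′ z) ∈ scanned I ⊎ (b , close′ z) ≡ (i , close′ x) → b ∈ i ∷ A
      closes (inj₁ b∈) = there (scanned-close I b∈)
      closes (inj₂ refl) = here refl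

    step-preserves : ∀ {κ c c'} → ScanInvariant E c → Step κ c c' → ScanInvariant E c'
    step-preserves I pushS        = push-preserves I
    step-preserves I delEmpty     = delete-unmatched-preserves I
    step-preserves I matchS       = match-preserves I
    step-preserves I (delTop _)   = delete-top-preserves I
    step-preserves I (delCur _)   = delete-current-preserves I
    step-preserves I delEnd       = delete-top-preserves I

    run-preserves : ∀ {c d} → ScanInvariant E c → Star AnyStep c d → ScanInvariant E d
    run-preserves I ε                = I
    run-preserves I ((_ , st) ◅ run) = run-preserves (step-preserves I st) run

    module _ {o} (O : ScanInvariant E o) where

      matched-left-not-close : ∀ {a b w} → (a , b) ∈ matches o → (a , close′ w) ∉ E
      matched-left-not-close p∈ a∈ with matched-in O p∈
      ... | _ , a∈′ , _ with ascending-functional asc (scanned⊆input O a∈′) a∈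
      ... | ()

      matched-right-not-open : ∀ {a b w} → (a , b) ∈ matches o → (b , open′ w) ∉ E
      matched-right-not-open p∈ b∈ with matched-in O p∈
      ... | _ , _ , b∈′ , _ with ascending-functional asc (scanned⊆input O b∈′) b∈
      ... | ()

      matched-right-congruent : ∀ {a b y} → (a , b) ∈ matches o →
                                (a , open′ y) ∈ E → (b , close′ y) ∈ E
      matched-right-congruent p∈ a∈ with matched-in O p∈
      ... | _ , a∈′ , b∈′ , _ with ascending-functional asc (scanned⊆input O a∈′) a∈
      ... | refl = scanned⊆input O b∈′

      partner-of-current : ∀ {i x r s A M D} →
                           ScanInvariant E ⟨ (i , close′ x) ∷ r , s , A , M , D ⟩ →
                           ∀ {a} → (a , i) ∈ matches o → a ∈ A ⊎ (a , x) ∈ s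
      partner-of-current I p∈ with matched-in O p∈
      ... | _ , a∈ , i∈ , a<i
        with ascending-functional asc (scanned⊆input O i∈) (rest⊆input I (here refl))
      ... | refl with input-scanned-or-rest I (scanned⊆input O a∈)
      ... | inj₁ a∈scanned     = scanned-open I a∈scanned
      ... | inj₂ (there a∈rest) =
        ⊥-elim (<-asym a<i (All.lookup (AllPairs.head (rest-ascending I)) a∈rest))

      current-partners-done : ∀ {i x r s A M D} →
                              ScanInvariant E ⟨ (i , close′ x) ∷ r , s , A , M , D ⟩ →
                              (∀ {a} → (a , i) ∈ matches o → (a , x) ∈ s → a ∈ A) →
                              PartnersDone (matches o) A i
      current-partners-done I stacked-done p∈ =
        (λ { refl → ⊥-elim (matched-left-not-close p∈ (rest⊆input I (here refl))) }) ,
        (λ { refl → [ id , stacked-done p∈ ]′ (partner-of-current I p∈) })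

      top-partners-done : ∀ {r j y s A M D} → ScanInvariant E ⟨ r , (j , y) ∷ s , A , M , D ⟩ →
                          (∀ {b} → (j , b) ∈ matches o → b ∈ A) → PartnersDone (matches o) A j
      top-partners-done I right-done p∈ =
        (λ { refl → right-done p∈ }) ,
        (λ { refl → ⊥-elim (matched-right-not-open p∈ (stacked⊆input I (here refl))) })

      Correct : Config k → Config k → Set
      Correct c c' = ∀ n → optMinus n (matches o) (done c') ≤ optMinus n (matches o) (done c)

      mismatch-correct : ∀ {i x r j y s A M D} → y ≢ x →
        (I : ScanInvariant E ⟨ (i , close′ x) ∷ r , (j , y) ∷ s , A , M , D ⟩) →
        ∃ λ c'' → Step delete ⟨ (i , close′ x) ∷ r , (j , y) ∷ s , A , M , D ⟩ c'' ×
                  Correct ⟨ (i , close′ x) ∷ r , (j , y) ∷ s , A , M , D ⟩ c''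
      mismatch-correct {i} {x} {j = j} {y} {s} {A} y≢x I
        with any? (λ p → (proj₁ p ≟ j) ×-dec ¬? (proj₂ p ∈? A)) (matches o)
      ... | no none =
        _ , delTop y≢x , λ n → optMinus-∷-≤ n (matches o) A j (top-partners-done I right-done)
        where
        right-done : ∀ {b} → (j , b) ∈ matches o → b ∈ A
        right-done {b} p∈ = decidable-stable (b ∈? A) (λ b∉A → none (lose p∈ (refl , b∉A)))
      ... | yes undone with find undone
      ... | (_ , b) , jb∈ , refl , b∉A =
        _ , delCur y≢x , λ n → optMinus-∷-≤ n (matches o) A i (current-partners-done I stacked-done)
        where
        j<i : j < i
        j<i = scanned-before-rest I (stacked-scanned I (here refl)) (here refl)
        i<b : i < b
        i<b with input-scanned-or-rest I (matched-right-congruent jb∈ (stacked⊆input I (here refl)))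
        ... | inj₁ b∈scanned      = ⊥-elim (b∉A (scanned-close I b∈scanned))
        ... | inj₂ (here refl)    = ⊥-elim (y≢x refl)
        ... | inj₂ (there b∈rest) = All.lookup (AllPairs.head (rest-ascending I)) b∈rest
        stacked-done : ∀ {a} → (a , i) ∈ matches o → (a , x) ∈ (j , y) ∷ s → a ∈ A
        stacked-done _ (here refl) = ⊥-elim (y≢x refl)
        stacked-done ai∈ (there a∈s) =
          ⊥-elim (noncrossing O ai∈ jb∈ (All.lookup (AllPairs.head (stack-descending I)) a∈s) j<i i<b)

      correct-deletion-exists : ∀ {c c'} → ScanInvariant E c → Step delete c c' →
                                ∃ λ c'' → Step delete c c'' × Correct c c''
      correct-deletion-exists I (delEmpty {i} {A = A}) =
        _ , delEmpty , λ n → optMinus-∷-≤ n (matches o) A i (current-partners-done I (λ _ ()))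
      correct-deletion-exists I (delEnd {j} {A = A}) =
        _ , delEnd , λ n → optMinus-∷-≤ n (matches o) A j (top-partners-done I right-done)
        where
        right-done : ∀ {b} → (j , b) ∈ matches o → b ∈ A
        right-done p∈ = [ scanned-close I , (λ ()) ]′
          (input-scanned-or-rest I (matched-right-congruent p∈ (stacked⊆input I (here refl))))
      correct-deletion-exists I (delTop y≢x) = mismatch-correct y≢x I
      correct-deletion-exists I (delCur y≢x) = mismatch-correct y≢x I

lemma3 : ∀ {k : ℕ} (σ : List (Sym k)) (opt : Config k) → OptimalRun σ opt →
         ∀ (c c' : Config k) → Reachable σ c → Step delete c c' →
         ∃ λ c'' → Step delete c c'' × CorrectMove σ (matches opt) c c''
lemma3 σ opt (opt-run , _) c c' c-run deletion =
  let c'' , step , correct = correct-deletion-exists asc (reach opt-run) (reach c-run) deletion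
  in c'' , step , correct (length σ)
  where
  asc : Ascending (zip (upTo (length σ)) σ)
  asc = upTo-zip-ascending (length σ) σ
  reach : ∀ {d} → Reachable σ d → ScanInvariant (zip (upTo (length σ)) σ) d
  reach = run-preserves asc (initial-invariant σ)
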